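{- $D^5(\mathbb{Z}_3^3)=9$; that is, every multiset of $9$ elements of $\mathbb{Z}_3^3$ contains a nonempty sub-multiset of at most $5$ elements with sum $0$, and there is a multiset of $8$ elements of $\mathbb{Z}_3^3$ without such a sub-multiset.
   Context: For a finite abelian group $G$ and integer $k$, $D^k(G)$ denotes the least integer $n$ such that every multiset of $n$ elements of $G$ contains a nonempty zerosum sub-multiset consisting of at most $k$ elements (counted with multiplicity). -}

module Defs where

open import Data.Nat using (ℕ; zero; suc; _≤_; _<_)
open import Data.Nat.DivMod using (_mod_)
open import Data.Fin using (Fin; toℕ)
open import Data.Fin.Subset using (Subset; inside; outside; ∣_∣; Nonempty)
open import Data.Vec using (Vec; []; _∷_)
open import Data.Product using (_×_; _,_)
open import Relation.Nullary using (¬_)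
open import Relation.Binary.PropositionalEquality using (_≡_)
import Data.Nat as ℕ

ℤ₃ : Set
ℤ₃ = Fin 3

_+₃_ : ℤ₃ → ℤ₃ → ℤ₃
a +₃ b = (toℕ a ℕ.+ toℕ b) mod 3

G : Set
G = ℤ₃ × ℤ₃ × ℤ₃

0G : G
0G = Data.Fin.zero , Data.Fin.zero , Data.Fin.zero

_+G_ : G → G → G
(a , b , c) +G (a' , b' , c') = (a +₃ a') , (b +₃ b') , (c +₃ c')

-- A multiset of n elements of G is represented by a vector of length n
-- (order is irrelevant).  A sub-multiset is given by a subset of the
-- index positions; its sum is the sum of the selected entries.
subSum : ∀ {n} → Vec G n → Subset n → G
subSum []       []            = 0G
subSum (x ∷ xs) (inside ∷ s)  = x +G subSum xs s
subSum (x ∷ xs) (outside ∷ s) = subSum xs s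

HasShortZeroSum : ℕ → ∀ {n} → Vec G n → Set
HasShortZeroSum k {n} xs =
  Data.Product.Σ (Subset n) λ s → Nonempty s × ∣ s ∣ ≤ k × subSum xs s ≡ 0G

DkProperty : ℕ → ℕ → Set
DkProperty k n = (xs : Vec G n) → HasShortZeroSum k xs

IsDk : ℕ → ℕ → Set
IsDk k d = DkProperty k d × (∀ m → m < d → ¬ DkProperty k m)

-- An injective linear map of G = ℤ₃³ reflects short zero-sums, so the nine elements may be
-- normalized one at a time: unless one of them is 0, we may assume one is e₁; unless the other
-- eight lie in ⟨e₁⟩, one of them is e₂; unless the other seven lie in ⟨e₁, e₂⟩, one of them is e₃.
-- The three remaining situations are finite: after sorting the other elements, a depth-first
-- search over sorted extensions finds, after each new element x, a short zero-sum through x.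
-- The lower bound is e₁, e₁, e₂, e₂, e₃, e₃, f, f with f = (1, 1, 2).

module Submission where

open import Data.Empty using () renaming (⊥ to False)
open import Data.Fin.Base using (zero; suc; toℕ)
open import Data.Fin.Properties using (all?) renaming (_≟_ to _≟₃_)
open import Data.Fin.Subset using (Subset; inside; outside; ∣_∣; Nonempty) renaming (⊥ to ∅)
open import Data.Fin.Subset.Properties using (anySubset?; nonempty?; ∣⊥∣≡0)
open import Data.List.Base using (List; allFin; cartesianProduct)
open import Data.List.Membership.Propositional using (_∈_)
open import Data.List.Membership.Propositional.Properties using (∈-allFin; ∈-cartesianProduct⁺)
import Data.List.Relation.Unary.All as ListAll
open import Data.Maybe.Base using (Maybe; just; nothing; _<∣>_) renaming (map to mapMaybe)
open import Data.Maybe.Relation.Unary.Any as MaybeAny using (satisfied) renaming (Any to IsJustWith)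
open import Data.Nat.Base
  using (ℕ; zero; suc; pred; _+_; _*_; _≤_; _<_; _≤′_; ≤′-refl; ≤′-step; z≤n; s≤s; s≤s⁻¹)
open import Data.Nat.DivMod using (_mod_)
open import Data.Nat.Properties using (_≤?_; ≰⇒≥; ≤⇒≤′)
open import Data.Product.Base as Product using (∃; ∃₂; _×_; _,_)
open import Data.Product.Properties using (≡-dec)
open import Data.Sum.Base using (_⊎_; inj₁; inj₂)
open import Data.Unit.Base using (⊤; tt)
open import Data.Vec.Base using (Vec; []; _∷_; _++_; map; here; there)
import Data.Vec.Properties as Vec
open import Data.Vec.Relation.Unary.All using (All; []; _∷_; universal)
open import Relation.Binary.Definitions using (DecidableEquality)
open import Relation.Nullary.Decidable using (Dec; yes; no; map′; from-yes; from-no; _×-dec_; _⊎-dec_; _→-dec_)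
open import Relation.Nullary.Negation using (¬_; contradiction)
open import Relation.Unary using (Pred; Decidable)
open import Relation.Binary.PropositionalEquality using (_≡_; refl; sym; trans; cong; cong₂; subst; module ≡-Reasoning)

open import Defs

infixl 30 _*₃_
_*₃_ : ℤ₃ → ℤ₃ → ℤ₃
a *₃ b = (toℕ a * toℕ b) mod 3

-- In ℤ₃ the negative of a is 2a = a + a.
infix 35 -₃_
-₃_ : ℤ₃ → ℤ₃
-₃ a = a +₃ a

+₃-medial : ∀ a b c d → (a +₃ b) +₃ (c +₃ d) ≡ (a +₃ c) +₃ (b +₃ d)
+₃-medial = from-yes (all? λ a → all? λ b → all? λ c → all? λ d →
  (a +₃ b) +₃ (c +₃ d) ≟₃ (a +₃ c) +₃ (b +₃ d))

+₃-lcomm : ∀ a b c → a +₃ (b +₃ c) ≡ b +₃ (a +₃ c)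
+₃-lcomm = from-yes (all? λ a → all? λ b → all? λ c → a +₃ (b +₃ c) ≟₃ b +₃ (a +₃ c))

*₃-distribˡ-+₃ : ∀ a b c → a *₃ (b +₃ c) ≡ (a *₃ b) +₃ (a *₃ c)
*₃-distribˡ-+₃ = from-yes (all? λ a → all? λ b → all? λ c → a *₃ (b +₃ c) ≟₃ (a *₃ b) +₃ (a *₃ c))

*₃-zeroʳ : ∀ a → a *₃ zero ≡ zero
*₃-zeroʳ = from-yes (all? λ a → a *₃ zero ≟₃ zero)

_≟G_ : DecidableEquality G
_≟G_ = ≡-dec _≟₃_ (≡-dec _≟₃_ _≟₃_)

elements : List G
elements = cartesianProduct (allFin 3) (cartesianProduct (allFin 3) (allFin 3))

∈-elements : ∀ x → x ∈ elements
∈-elements (a , b , c) = ∈-cartesianProduct⁺ (∈-allFin a) (∈-cartesianProduct⁺ (∈-allFin b) (∈-allFin c))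

∀G? : ∀ {p} {P : Pred G p} → Decidable P → Dec (∀ x → P x)
∀G? P? = map′ (λ all x → ListAll.lookup all (∈-elements x)) (λ all → ListAll.tabulate (λ {x} _ → all x))
  (ListAll.all? P? elements)

-G_ : G → G
-G (a , b , c) = -₃ a , -₃ b , -₃ c

+G-lcomm : ∀ x y z → x +G (y +G z) ≡ y +G (x +G z)
+G-lcomm (a , b , c) (a′ , b′ , c′) (a″ , b″ , c″) =
  cong₂ _,_ (+₃-lcomm a a′ a″) (cong₂ _,_ (+₃-lcomm b b′ b″) (+₃-lcomm c c′ c″))

-- Linear maps, given by the rows of their matrix

infix 30 _∙_
_∙_ : G → G → ℤ₃
(a , b , c) ∙ (x , y , z) = (a *₃ x +₃ b *₃ y) +₃ c *₃ z

∙-+G : ∀ r x y → r ∙ (x +G y) ≡ r ∙ x +₃ r ∙ y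
∙-+G (a , b , c) (x , y , z) (x′ , y′ , z′) = begin
  (a *₃ (x +₃ x′) +₃ b *₃ (y +₃ y′)) +₃ c *₃ (z +₃ z′)
    ≡⟨ cong₂ _+₃_ (cong₂ _+₃_ (*₃-distribˡ-+₃ a x x′) (*₃-distribˡ-+₃ b y y′)) (*₃-distribˡ-+₃ c z z′) ⟩
  ((a *₃ x +₃ a *₃ x′) +₃ (b *₃ y +₃ b *₃ y′)) +₃ (c *₃ z +₃ c *₃ z′)
    ≡⟨ cong (_+₃ (c *₃ z +₃ c *₃ z′)) (+₃-medial (a *₃ x) (a *₃ x′) (b *₃ y) (b *₃ y′)) ⟩
  ((a *₃ x +₃ b *₃ y) +₃ (a *₃ x′ +₃ b *₃ y′)) +₃ (c *₃ z +₃ c *₃ z′)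
    ≡⟨ +₃-medial (a *₃ x +₃ b *₃ y) (a *₃ x′ +₃ b *₃ y′) (c *₃ z) (c *₃ z′) ⟩
  ((a *₃ x +₃ b *₃ y) +₃ c *₃ z) +₃ ((a *₃ x′ +₃ b *₃ y′) +₃ c *₃ z′)
    ∎
  where open ≡-Reasoning

∙-0G : ∀ r → r ∙ 0G ≡ zero
∙-0G (a , b , c) rewrite *₃-zeroʳ a | *₃-zeroʳ b | *₃-zeroʳ c = refl

Mat : Set
Mat = G × G × G

apply : Mat → G → G
apply (r₁ , r₂ , r₃) x = r₁ ∙ x , r₂ ∙ x , r₃ ∙ x

apply-+G : ∀ M x y → apply M (x +G y) ≡ apply M x +G apply M y
apply-+G (r₁ , r₂ , r₃) x y = cong₂ _,_ (∙-+G r₁ x y) (cong₂ _,_ (∙-+G r₂ x y) (∙-+G r₃ x y))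

apply-0G : ∀ M → apply M 0G ≡ 0G
apply-0G (r₁ , r₂ , r₃) = cong₂ _,_ (∙-0G r₁) (cong₂ _,_ (∙-0G r₂) (∙-0G r₃))

_·_ : ℤ₃ → G → G
s · (a , b , c) = s *₃ a , s *₃ b , s *₃ c

cross : G → G → G
cross (a , b , c) (x , y , z) = b *₃ z +₃ -₃ (c *₃ y) , c *₃ x +₃ -₃ (a *₃ z) , a *₃ y +₃ -₃ (b *₃ x)

-- Cramer's rule: the rows of the inverse of the matrix with columns u, v, w are the cross products
-- v × w, w × u, u × v divided by the determinant; every unit of ℤ₃ is its own inverse.  Nothing
-- is proved about this formula: the maps it yields below are checked directly.
coordinates : G → G → G → Mat
coordinates u v w = det · cross v w , det · cross w u , det · cross u v
  where det = u ∙ cross v w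

ShortZeroSumAt : ℕ → ∀ {n} → Vec G n → Subset n → Set
ShortZeroSumAt k xs s = Nonempty s × ∣ s ∣ ≤ k × subSum xs s ≡ 0G

shortZeroSumAt? : ∀ k {n} (xs : Vec G n) → Decidable (ShortZeroSumAt k xs)
shortZeroSumAt? k xs s = nonempty? s ×-dec (∣ s ∣ ≤? k) ×-dec (subSum xs s ≟G 0G)

hasShortZeroSum? : ∀ k {n} (xs : Vec G n) → Dec (HasShortZeroSum k xs)
hasShortZeroSum? k xs = anySubset? (shortZeroSumAt? k xs)

∣p∣>0⇒Nonempty : ∀ {n} (p : Subset n) → 0 < ∣ p ∣ → Nonempty p
∣p∣>0⇒Nonempty (inside ∷ p)  _     = zero , here
∣p∣>0⇒Nonempty (outside ∷ p) 0<∣p∣ = Product.map suc there (∣p∣>0⇒Nonempty p 0<∣p∣)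

Nonempty⇒∣p∣>0 : ∀ {n} {p : Subset n} → Nonempty p → 0 < ∣ p ∣
Nonempty⇒∣p∣>0 {p = inside ∷ p}  _                   = s≤s z≤n
Nonempty⇒∣p∣>0 {p = outside ∷ p} (suc i , there i∈p) = Nonempty⇒∣p∣>0 (i , i∈p)

HasShortZeroSum-reindex : ∀ {k m n} (xs : Vec G m) (ys : Vec G n) (s : Subset m) (t : Subset n) →
                          ∣ t ∣ ≡ ∣ s ∣ → subSum ys t ≡ subSum xs s → ShortZeroSumAt k xs s → HasShortZeroSum k ys
HasShortZeroSum-reindex {k} _ _ s t ∣t∣≡∣s∣ Σt≡Σs (nonempty , ∣s∣≤k , Σs≡0) =
  t , ∣p∣>0⇒Nonempty t (subst (0 <_) (sym ∣t∣≡∣s∣) (Nonempty⇒∣p∣>0 nonempty))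
    , subst (_≤ k) (sym ∣t∣≡∣s∣) ∣s∣≤k
    , trans Σt≡Σs Σs≡0

subSum-∅ : ∀ {n} (xs : Vec G n) → subSum xs ∅ ≡ 0G
subSum-∅ []       = refl
subSum-∅ (x ∷ xs) = subSum-∅ xs

subSum-++-∅ : ∀ {m n} (xs : Vec G m) (ys : Vec G n) (s : Subset m) →
              ∣ s ++ ∅ {n} ∣ ≡ ∣ s ∣ × subSum (xs ++ ys) (s ++ ∅) ≡ subSum xs s
subSum-++-∅ {n = n} []  ys []            = ∣⊥∣≡0 n , subSum-∅ ys
subSum-++-∅ (x ∷ xs)     ys (inside ∷ s)  = Product.map (cong suc) (cong (x +G_)) (subSum-++-∅ xs ys s)
subSum-++-∅ (x ∷ xs)     ys (outside ∷ s) = subSum-++-∅ xs ys s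

HasShortZeroSum-++ : ∀ {k m n} (xs : Vec G m) (ys : Vec G n) → HasShortZeroSum k xs → HasShortZeroSum k (xs ++ ys)
HasShortZeroSum-++ {n = n} xs ys (s , zeroSum) =
  let ∣s++∅∣≡∣s∣ , Σs++∅≡Σs = subSum-++-∅ xs ys s
  in HasShortZeroSum-reindex xs (xs ++ ys) s (s ++ ∅ {n}) ∣s++∅∣≡∣s∣ Σs++∅≡Σs zeroSum

HasShortZeroSum-∷ : ∀ {k n} x {xs : Vec G n} → HasShortZeroSum k xs → HasShortZeroSum k (x ∷ xs)
HasShortZeroSum-∷ x (s , nonempty , ∣s∣≤k , Σs≡0) = outside ∷ s , Product.map suc there nonempty , ∣s∣≤k , Σs≡0

HasShortZeroSum-0G : ∀ {k n} {x} (xs : Vec G n) → x ≡ 0G → HasShortZeroSum (suc k) (x ∷ xs)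
HasShortZeroSum-0G {k} {n} xs refl =
  inside ∷ ∅ , (zero , here) , s≤s (subst (_≤ k) (sym (∣⊥∣≡0 n)) z≤n) , cong (0G +G_) (subSum-∅ xs)

module _ (φ : G → G) (φ-+G : ∀ x y → φ (x +G y) ≡ φ x +G φ y) (φ-0G : φ 0G ≡ 0G) where

  subSum-map : ∀ {n} (xs : Vec G n) s → subSum (map φ xs) s ≡ φ (subSum xs s)
  subSum-map []       []            = sym φ-0G
  subSum-map (x ∷ xs) (inside ∷ s)  = trans (cong (φ x +G_) (subSum-map xs s)) (sym (φ-+G x (subSum xs s)))
  subSum-map (x ∷ xs) (outside ∷ s) = subSum-map xs s

  HasShortZeroSum-map⁻ : (∀ x → φ x ≡ 0G → x ≡ 0G) →
                         ∀ {k n} (xs : Vec G n) → HasShortZeroSum k (map φ xs) → HasShortZeroSum k xs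
  HasShortZeroSum-map⁻ ker≡0 xs (s , nonempty , ∣s∣≤k , Σs≡0) =
    s , nonempty , ∣s∣≤k , ker≡0 _ (trans (sym (subSum-map xs s)) Σs≡0)

infix 4 _↭_
data _↭_ {A : Set} : ∀ {m n} → Vec A m → Vec A n → Set where
  []      : [] ↭ []
  prep    : ∀ {m n} x {xs : Vec A m} {ys : Vec A n} → xs ↭ ys → x ∷ xs ↭ x ∷ ys
  swap    : ∀ {m n} x y {xs : Vec A m} {ys : Vec A n} → xs ↭ ys → x ∷ y ∷ xs ↭ y ∷ x ∷ ys
  ↭-trans : ∀ {l m n} {xs : Vec A l} {ys : Vec A m} {zs : Vec A n} → xs ↭ ys → ys ↭ zs → xs ↭ zs

module _ {A : Set} where

  ↭-refl : ∀ {n} (xs : Vec A n) → xs ↭ xs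
  ↭-refl []       = []
  ↭-refl (x ∷ xs) = prep x (↭-refl xs)

  ↭-++⁺ˡ : ∀ {k m n} (p : Vec A k) {xs : Vec A m} {ys : Vec A n} → xs ↭ ys → p ++ xs ↭ p ++ ys
  ↭-++⁺ˡ []      xs↭ys = xs↭ys
  ↭-++⁺ˡ (x ∷ p) xs↭ys = prep x (↭-++⁺ˡ p xs↭ys)

  ↭-shift : ∀ {m n} (xs : Vec A m) y (ys : Vec A n) → xs ++ y ∷ ys ↭ y ∷ xs ++ ys
  ↭-shift []       y ys = ↭-refl _
  ↭-shift (x ∷ xs) y ys = ↭-trans (prep x (↭-shift xs y ys)) (swap x y (↭-refl _))

  All-↭ : ∀ {P : A → Set} {m n} {xs : Vec A m} {ys : Vec A n} → xs ↭ ys → All P xs → All P ys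
  All-↭ []                    []              = []
  All-↭ (prep x xs↭ys)        (px ∷ pxs)      = px ∷ All-↭ xs↭ys pxs
  All-↭ (swap x y xs↭ys)      (px ∷ py ∷ pxs) = py ∷ px ∷ All-↭ xs↭ys pxs
  All-↭ (↭-trans xs↭ys ys↭zs) pxs             = All-↭ ys↭zs (All-↭ xs↭ys pxs)

subSum-↭ : ∀ {m n} {xs : Vec G m} {ys : Vec G n} → xs ↭ ys → ∀ t →
           ∃ λ s → ∣ s ∣ ≡ ∣ t ∣ × subSum xs s ≡ subSum ys t
subSum-↭ [] [] = [] , refl , refl
subSum-↭ (prep x xs↭ys) (inside ∷ t) =
  let s , ∣s∣≡∣t∣ , Σs≡Σt = subSum-↭ xs↭ys t in inside ∷ s , cong suc ∣s∣≡∣t∣ , cong (x +G_) Σs≡Σt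
subSum-↭ (prep x xs↭ys) (outside ∷ t) =
  let s , ∣s∣≡∣t∣ , Σs≡Σt = subSum-↭ xs↭ys t in outside ∷ s , ∣s∣≡∣t∣ , Σs≡Σt
subSum-↭ (swap x y xs↭ys) (_ ∷ _ ∷ t) with subSum-↭ xs↭ys t
subSum-↭ (swap x y {xs} xs↭ys) (inside ∷ inside ∷ t) | s , ∣s∣≡∣t∣ , Σs≡Σt =
  inside ∷ inside ∷ s , cong (2 +_) ∣s∣≡∣t∣ ,
  trans (+G-lcomm x y (subSum xs s)) (cong (λ z → y +G (x +G z)) Σs≡Σt)
subSum-↭ (swap x y xs↭ys) (inside ∷ outside ∷ t) | s , ∣s∣≡∣t∣ , Σs≡Σt =
  outside ∷ inside ∷ s , cong suc ∣s∣≡∣t∣ , cong (y +G_) Σs≡Σt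
subSum-↭ (swap x y xs↭ys) (outside ∷ inside ∷ t) | s , ∣s∣≡∣t∣ , Σs≡Σt =
  inside ∷ outside ∷ s , cong suc ∣s∣≡∣t∣ , cong (x +G_) Σs≡Σt
subSum-↭ (swap x y xs↭ys) (outside ∷ outside ∷ t) | s , ∣s∣≡∣t∣ , Σs≡Σt =
  outside ∷ outside ∷ s , ∣s∣≡∣t∣ , Σs≡Σt
subSum-↭ (↭-trans xs↭ys ys↭zs) u =
  let t , ∣t∣≡∣u∣ , Σt≡Σu = subSum-↭ ys↭zs u
      s , ∣s∣≡∣t∣ , Σs≡Σt = subSum-↭ xs↭ys t
  in s , trans ∣s∣≡∣t∣ ∣t∣≡∣u∣ , trans Σs≡Σt Σt≡Σu

HasShortZeroSum-↭ : ∀ {k m n} {xs : Vec G m} {ys : Vec G n} → xs ↭ ys → HasShortZeroSum k ys → HasShortZeroSum k xs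
HasShortZeroSum-↭ {xs = xs} {ys} xs↭ys (t , zeroSum) =
  let s , ∣s∣≡∣t∣ , Σs≡Σt = subSum-↭ xs↭ys t
  in HasShortZeroSum-reindex ys xs t s ∣s∣≡∣t∣ Σs≡Σt zeroSum

module _ {A : Set} {P : A → Set} (P? : Decidable P) where

  pick : ∀ {n} (xs : Vec A (suc n)) → All P xs ⊎ ∃₂ λ y (ys : Vec A n) → ¬ P y × xs ↭ y ∷ ys
  pick {zero}  (x ∷ []) with P? x
  ... | yes px = inj₁ (px ∷ [])
  ... | no ¬px = inj₂ (x , [] , ¬px , ↭-refl _)
  pick {suc n} (x ∷ xs) with P? x
  ... | no ¬px = inj₂ (x , xs , ¬px , ↭-refl _)
  ... | yes px with pick xs
  ...   | inj₁ pxs = inj₁ (px ∷ pxs)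
  ...   | inj₂ (y , ys , ¬py , xs↭y∷ys) =
    inj₂ (y , x ∷ ys , ¬py , ↭-trans (prep x xs↭y∷ys) (swap x y (↭-refl _)))

module InsertionSort {A : Set} (key : A → ℕ) where

  SortedFrom : ℕ → ∀ {n} → Vec A n → Set
  SortedFrom lo []       = ⊤
  SortedFrom lo (x ∷ xs) = lo ≤ key x × SortedFrom (key x) xs

  insert : ∀ {n} → A → Vec A n → Vec A (suc n)
  insert x []       = x ∷ []
  insert x (y ∷ ys) with key x ≤? key y
  ... | yes _ = x ∷ y ∷ ys
  ... | no  _ = y ∷ insert x ys

  sort : ∀ {n} → Vec A n → Vec A n
  sort []       = []
  sort (x ∷ xs) = insert x (sort xs)

  insert-↭ : ∀ {n} x (ys : Vec A n) → x ∷ ys ↭ insert x ys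
  insert-↭ x []       = ↭-refl _
  insert-↭ x (y ∷ ys) with key x ≤? key y
  ... | yes _ = ↭-refl _
  ... | no  _ = ↭-trans (swap x y (↭-refl ys)) (prep y (insert-↭ x ys))

  sort-↭ : ∀ {n} (xs : Vec A n) → xs ↭ sort xs
  sort-↭ []       = []
  sort-↭ (x ∷ xs) = ↭-trans (prep x (sort-↭ xs)) (insert-↭ x (sort xs))

  insert-sorted : ∀ {lo n} x {ys : Vec A n} → lo ≤ key x → SortedFrom lo ys → SortedFrom lo (insert x ys)
  insert-sorted x {[]}     lo≤x _ = lo≤x , tt
  insert-sorted x {y ∷ ys} lo≤x (lo≤y , sorted) with key x ≤? key y
  ... | yes x≤y = lo≤x , x≤y , sorted
  ... | no  x≰y = lo≤y , insert-sorted x (≰⇒≥ x≰y) sorted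

  sort-sorted : ∀ {n} (xs : Vec A n) → SortedFrom 0 (sort xs)
  sort-sorted []       = tt
  sort-sorted (x ∷ xs) = insert-sorted x z≤n (sort-sorted xs)

subsetWithSum : ℕ → G → ∀ {n} → Vec G n → Maybe (Subset n)
subsetWithSum zero    t xs with t ≟G 0G
... | yes _ = just ∅
... | no  _ = nothing
subsetWithSum (suc b) t []       = subsetWithSum zero t []
subsetWithSum (suc b) t (x ∷ xs) =
  mapMaybe (inside ∷_) (subsetWithSum b (t +G (-G x)) xs) <∣> mapMaybe (outside ∷_) (subsetWithSum (suc b) t xs)

code : G → ℕ
code (a , b , c) = (toℕ a * 9 + toℕ b * 3) + toℕ c

module ExhaustiveSearch (k : ℕ) {P : G → Set} (P? : Decidable P) where

  open InsertionSort code

  candidate : ∀ {n} → Vec G n → Maybe (Subset n)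
  candidate []       = nothing
  candidate (x ∷ xs) = mapMaybe (inside ∷_) (subsetWithSum (pred k) (-G x) xs)

  Closes : ∀ {n} → Vec G n → Set
  Closes xs = IsJustWith (ShortZeroSumAt k xs) (candidate xs)

  -- Every extension of r by m sorted elements of code ≥ lo satisfying P has a new element x
  -- for which candidate finds a short zero-sum through x among x and the elements before it.
  Exhausts : ℕ → ∀ {ℓ} → Vec G ℓ → ℕ → Set
  Exhausts zero    r lo = False
  Exhausts (suc m) r lo = ∀ x → lo ≤ code x → P x → Closes (x ∷ r) ⊎ Exhausts m (x ∷ r) (code x)

  exhausts? : ∀ m {ℓ} (r : Vec G ℓ) lo → Dec (Exhausts m r lo)
  exhausts? zero    r lo = no λ ()
  exhausts? (suc m) r lo = ∀G? λ x → lo ≤? code x →-dec P? x →-dec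
    (MaybeAny.dec (shortZeroSumAt? k (x ∷ r)) (candidate (x ∷ r)) ⊎-dec exhausts? m (x ∷ r) (code x))

  Exhausts-sound : ∀ m {ℓ} {r : Vec G ℓ} {lo} → Exhausts m r lo →
                   ∀ (w : Vec G m) → SortedFrom lo w → All P w → HasShortZeroSum k (r ++ w)
  Exhausts-sound (suc m) {r = r} exhausts (x ∷ w) (lo≤x , sorted) (px ∷ pw) =
    HasShortZeroSum-↭ (↭-shift r x w) (extend (exhausts x lo≤x px))
    where
    extend : Closes (x ∷ r) ⊎ Exhausts m (x ∷ r) (code x) → HasShortZeroSum k (x ∷ r ++ w)
    extend (inj₁ closes)    = HasShortZeroSum-++ (x ∷ r) w (satisfied closes)
    extend (inj₂ exhausts′) = Exhausts-sound m exhausts′ w sorted pw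

  exhaustive : ∀ {m ℓ} (r : Vec G ℓ) → Exhausts m r 0 →
               ∀ (w : Vec G m) → All P w → HasShortZeroSum k (r ++ w)
  exhaustive {m} r exhausts w pw =
    HasShortZeroSum-↭ (↭-++⁺ˡ r (sort-↭ w))
      (Exhausts-sound m exhausts (sort w) (sort-sorted w) (All-↭ (sort-↭ w) pw))

Normalizes : Mat → ∀ {d} → Vec G d → G → G → Set
Normalizes M p c e = (∀ x → apply M x ≡ 0G → x ≡ 0G) × map (apply M) p ≡ p × apply M c ≡ e

normalizes? : ∀ M {d} (p : Vec G d) c e → Dec (Normalizes M p c e)
normalizes? M p c e =
  ∀G? (λ x → apply M x ≟G 0G →-dec x ≟G 0G) ×-dec Vec.≡-dec _≟G_ (map (apply M) p) p ×-dec apply M c ≟G e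

reduceByNormalizer : ∀ {k d m} {P : G → Set} → Decidable P → (p : Vec G d) (e : G) (φ : G → Mat) →
                     (∀ c → P c ⊎ Normalizes (φ c) p c e) →
                     (∀ (W : Vec G (suc m)) → All P W → HasShortZeroSum k (p ++ W)) →
                     (∀ (R : Vec G m) → HasShortZeroSum k (p ++ e ∷ R)) →
                     ∀ W → HasShortZeroSum k (p ++ W)
reduceByNormalizer P? p e φ normalizes degenerate general W with pick P? W
... | inj₁ pW = degenerate W pW
... | inj₂ (c , R , ¬pc , W↭c∷R) with normalizes c
...   | inj₁ pc = contradiction pc ¬pc
...   | inj₂ (ker≡0 , p↦p , c↦e) =
  HasShortZeroSum-↭ (↭-++⁺ˡ p W↭c∷R)
    (HasShortZeroSum-map⁻ (apply (φ c)) (apply-+G (φ c)) (apply-0G (φ c)) ker≡0 (p ++ c ∷ R)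
      (subst (HasShortZeroSum _) image (general (map (apply (φ c)) R))))
  where
  image : p ++ e ∷ map (apply (φ c)) R ≡ map (apply (φ c)) (p ++ c ∷ R)
  image = begin
    p ++ e ∷ map (apply (φ c)) R                          ≡⟨ cong₂ (λ q f → q ++ f ∷ _) (sym p↦p) (sym c↦e) ⟩
    map (apply (φ c)) p ++ map (apply (φ c)) (c ∷ R)       ≡⟨ Vec.map-++ (apply (φ c)) p (c ∷ R) ⟨
    map (apply (φ c)) (p ++ c ∷ R)                        ∎
    where open ≡-Reasoning

e₁ e₂ e₃ : G
e₁ = suc zero , zero , zero
e₂ = zero , suc zero , zero
e₃ = zero , zero , suc zero

In⟨e₁⟩ : G → Set
In⟨e₁⟩ (_ , b , c) = b ≡ zero × c ≡ zero

in⟨e₁⟩? : Decidable In⟨e₁⟩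
in⟨e₁⟩? (_ , b , c) = b ≟₃ zero ×-dec c ≟₃ zero

In⟨e₁,e₂⟩ : G → Set
In⟨e₁,e₂⟩ (_ , _ , c) = c ≡ zero

in⟨e₁,e₂⟩? : Decidable In⟨e₁,e₂⟩
in⟨e₁,e₂⟩? (_ , _ , c) = c ≟₃ zero

normalizer₁ : G → Mat
normalizer₁ a@(suc _ , _ , _)    = coordinates a e₂ e₃
normalizer₁ a@(zero , suc _ , _) = coordinates a e₁ e₃
normalizer₁ a                    = coordinates a e₁ e₂

normalizer₂ : G → Mat
normalizer₂ b@(_ , suc _ , _) = coordinates e₁ b e₃
normalizer₂ b                 = coordinates e₁ b e₂

normalizer₃ : G → Mat
normalizer₃ c = coordinates e₁ e₂ c

normalizes₁ : ∀ a → a ≡ 0G ⊎ Normalizes (normalizer₁ a) [] a e₁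
normalizes₁ = from-yes (∀G? λ a → a ≟G 0G ⊎-dec normalizes? (normalizer₁ a) [] a e₁)

normalizes₂ : ∀ b → In⟨e₁⟩ b ⊎ Normalizes (normalizer₂ b) (e₁ ∷ []) b e₂
normalizes₂ = from-yes (∀G? λ b → in⟨e₁⟩? b ⊎-dec normalizes? (normalizer₂ b) (e₁ ∷ []) b e₂)

normalizes₃ : ∀ c → In⟨e₁,e₂⟩ c ⊎ Normalizes (normalizer₃ c) (e₁ ∷ e₂ ∷ []) c e₃
normalizes₃ = from-yes (∀G? λ c → in⟨e₁,e₂⟩? c ⊎-dec normalizes? (normalizer₃ c) (e₁ ∷ e₂ ∷ []) c e₃)

search₁ : ExhaustiveSearch.Exhausts 5 in⟨e₁⟩? 8 (e₁ ∷ []) 0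
search₁ = from-yes (ExhaustiveSearch.exhausts? 5 in⟨e₁⟩? 8 (e₁ ∷ []) 0)

search₂ : ExhaustiveSearch.Exhausts 5 in⟨e₁,e₂⟩? 7 (e₁ ∷ e₂ ∷ []) 0
search₂ = from-yes (ExhaustiveSearch.exhausts? 5 in⟨e₁,e₂⟩? 7 (e₁ ∷ e₂ ∷ []) 0)

search₃ : ExhaustiveSearch.Exhausts 5 (λ _ → yes tt) 6 (e₁ ∷ e₂ ∷ e₃ ∷ []) 0
search₃ = from-yes (ExhaustiveSearch.exhausts? 5 (λ _ → yes tt) 6 (e₁ ∷ e₂ ∷ e₃ ∷ []) 0)

upperBound : DkProperty 5 9
upperBound =
  reduceByNormalizer (_≟G 0G) [] e₁ normalizer₁ normalizes₁
    (λ { (x ∷ W) (x≡0 ∷ _) → HasShortZeroSum-0G W x≡0 })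
  (reduceByNormalizer in⟨e₁⟩? (e₁ ∷ []) e₂ normalizer₂ normalizes₂
    (ExhaustiveSearch.exhaustive 5 in⟨e₁⟩? (e₁ ∷ []) search₁)
  (reduceByNormalizer in⟨e₁,e₂⟩? (e₁ ∷ e₂ ∷ []) e₃ normalizer₃ normalizes₃
    (ExhaustiveSearch.exhaustive 5 in⟨e₁,e₂⟩? (e₁ ∷ e₂ ∷ []) search₂)
  (λ R → ExhaustiveSearch.exhaustive 5 (λ _ → yes tt) (e₁ ∷ e₂ ∷ e₃ ∷ []) search₃ R (universal _ R))))

DkProperty-suc : ∀ {k n} → DkProperty k n → DkProperty k (suc n)
DkProperty-suc D (x ∷ xs) = HasShortZeroSum-∷ x (D xs)

DkProperty-mono : ∀ {k m n} → m ≤′ n → DkProperty k m → DkProperty k n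
DkProperty-mono ≤′-refl        D = D
DkProperty-mono (≤′-step m≤′n) D = DkProperty-suc (DkProperty-mono m≤′n D)

extremal : Vec G 8
extremal = e₁ ∷ e₁ ∷ e₂ ∷ e₂ ∷ e₃ ∷ e₃ ∷ f ∷ f ∷ []
  where f = e₁ +G (e₂ +G (e₃ +G e₃))

extremal-noShortZeroSum : ¬ HasShortZeroSum 5 extremal
extremal-noShortZeroSum = from-no (hasShortZeroSum? 5 extremal)

mainTheorem9 : IsDk 5 9
mainTheorem9 = upperBound , λ m m<9 D →
  extremal-noShortZeroSum (DkProperty-mono (≤⇒≤′ (s≤s⁻¹ m<9)) D extremal)
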